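{- Let $G$ be a graph and let $X\subseteq V(G)$ be such that $G- X$ is a cluster graph. Then $\chi_{ssc}(G)\le |X|+1$.
   Context: Graphs are finite, simple and undirected. For a vertex $v$, $N(v)$ is its open neighbourhood, $N[v]=N(v)\cup\{v\}$ and $\deg(v)=|N(v)|$. For a positive integer $q$, a $q$-subset square colouring of a graph $G$ is a function $c:V(G)\to\{c_0,c_1,\dots,c_q\}$ such that (i) for every vertex $v$ and every $i\in\{1,\dots,q\}$, $|c^{ -1}(c_i)\cap N[v]|\le 1$, and (ii) for every vertex $v$, $N[v]$ contains at most $\deg(v)$ vertices of colour $c_0$ (equivalently, $N[v]$ contains at least one vertex whose colour lies in $\{c_1,\dots,c_q\}$). $\chi_{ssc}(G)$ is the minimum $q$ such that $G$ admits a $q$-subset square colouring. A cluster graph is a disjoint union of complete graphs. -}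

module Defs where

open import Data.Nat using (ℕ; zero; suc; _≤_; _+_)
open import Data.Fin using (Fin; zero; suc; _≟_)
open import Data.Fin.Subset using (Subset; _∈_; _∉_; ∣_∣)
open import Data.Bool using (Bool; true; false; _∨_; _∧_; not)
open import Data.List using (List; filter; length)
open import Data.List.Base using (allFin)
open import Data.Product using (Σ; _×_; ∃)
open import Relation.Binary.PropositionalEquality using (_≡_; _≢_)
open import Relation.Nullary.Decidable using (⌊_⌋)
open import Data.Bool using (T)
open import Relation.Unary using (Decidable)
open import Data.Bool.Properties using (T?)

record Graph : Set where
  field
    n      : ℕ
    adj    : Fin n → Fin n → Bool
    sym    : ∀ u v → adj u v ≡ adj v u
    irrefl : ∀ v → adj v v ≡ false

open Graph public

count : ∀ {n} → (Fin n → Bool) → ℕ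
count {n} p = length (filter (λ u → T? (p u)) (allFin n))

inClosedNbhd : (G : Graph) → Fin (n G) → Fin (n G) → Bool
inClosedNbhd G v u = ⌊ u ≟ v ⌋ ∨ adj G v u

deg : (G : Graph) → Fin (n G) → ℕ
deg G v = count (adj G v)

-- Colours: Fin (suc q); colour zero is c₀, colour (suc i) is c_{i+1}.
isZero : ∀ {q} → Fin (suc q) → Bool
isZero zero    = true
isZero (suc _) = false

record IsSubsetSquareColouring (G : Graph) (q : ℕ) (c : Fin (n G) → Fin (suc q)) : Set where
  field
    cond-i  : ∀ (v : Fin (n G)) (i : Fin q) →
              count (λ u → inClosedNbhd G v u ∧ ⌊ c u ≟ suc i ⌋) ≤ 1
    cond-ii : ∀ (v : Fin (n G)) →
              count (λ u → inClosedNbhd G v u ∧ isZero (c u)) ≤ deg G v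

HasSSC : Graph → ℕ → Set
HasSSC G q = Σ (Fin (n G) → Fin (suc q)) (IsSubsetSquareColouring G q)

χssc≤ : Graph → ℕ → Set
χssc≤ G k = Σ ℕ λ q → (1 ≤ q) × (q ≤ k) × HasSSC G q

-- G - X is a cluster graph (disjoint union of complete graphs): there is a
-- labelling of the vertices of G - X by clique indices such that two distinct
-- vertices outside X are adjacent iff they lie in the same clique.
IsClusterAfterDeleting : (G : Graph) → Subset (n G) → Set
IsClusterAfterDeleting G X =
  Σ (Fin (n G) → ℕ) λ part →
    ∀ (u v : Fin (n G)) → u ∉ X → v ∉ X → u ≢ v →
      (adj G u v ≡ true → part u ≡ part v) × (part u ≡ part v → adj G u v ≡ true)

-- Give the vertices of X the distinct colours 1, …, |X|. In every clique of G − X that contains a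
-- vertex with no neighbour in X, give the least such vertex (its representative) the colour |X| + 1,
-- and colour all remaining vertices c₀. A representative lies in N[v] only for v in its own clique,
-- so no closed neighbourhood contains two vertices of colour |X| + 1. Every N[v] contains a vertex not
-- coloured c₀ (v itself if v ∈ X, else a neighbour in X if there is one, else the representative of
-- the clique of v), so at most |N[v]| − 1 = deg v of its vertices are coloured c₀.
module Submission where

open import Defs hiding (sym)
open import Data.Nat using (ℕ; suc)
open import Data.Fin.Subset using (Subset; ∣_∣)

open import Data.Bool using (Bool; true; false; T; _∧_; _∨_; if_then_else_)
open import Data.Bool.Properties using (T?; T-∧; T-∨; T-≡)
open import Data.Empty using (⊥-elim)
open import Data.Fin using (Fin; zero; suc; _≟_; inject₁; fromℕ; _≤_; _≤?_)
open import Data.Fin.Properties using (0≢1+n; suc-injective; fromℕ≢inject₁; inject₁-injective; ≤-antisym; all?; any?)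
open import Data.Fin.Subset using (_∈_; _∉_; inside; outside)
open import Data.Fin.Subset.Properties using (_∈?_)
open import Data.List using (List; []; _∷_; map; filter; length; tabulate; allFin)
open import Data.List.Properties using (map-tabulate; filter-none)
open import Data.List.Relation.Unary.All.Properties using (tabulate⁺)
open import Data.Product using (∃; _×_; _,_; proj₁; proj₂)
open import Data.Sum using (_⊎_; inj₁; inj₂; map₁)
open import Data.Vec using (_∷_; here; there)
open import Function using (_∘_; id; case_of_; Equivalence)
open import Level using (Level)
open import Relation.Binary.PropositionalEquality using (_≡_; _≢_; refl; sym; trans; cong; subst; module ≡-Reasoning)
open import Relation.Nullary using (¬_; does; yes; no; contradiction)
open import Relation.Nullary.Decidable using (⌊_⌋; ⌊⌋-map′; toWitness; fromWitness; _×-dec_; _→-dec_; ¬?)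
open import Relation.Unary using (Pred; Decidable; _⊆_)

import Data.Nat as ℕ
import Data.Nat.Properties as ℕₚ

private
  variable
    a b ℓ : Level
    A : Set a
    B : Set b
    k : ℕ

length-filter-map : {P : Pred B ℓ} (P? : Decidable P) (f : A → B) (xs : List A) →
                    length (filter P? (map f xs)) ≡ length (filter (P? ∘ f) xs)
length-filter-map P? f [] = refl
length-filter-map P? f (x ∷ xs) with does (P? (f x))
... | true  = cong suc (length-filter-map P? f xs)
... | false = length-filter-map P? f xs

count-tail : (p : Fin (suc k) → Bool) → length (filter (T? ∘ p) (tabulate suc)) ≡ count (p ∘ suc)
count-tail {k} p = trans (cong (length ∘ filter (T? ∘ p)) (sym (map-tabulate id suc)))
                         (length-filter-map (T? ∘ p) suc (allFin k))

count-suc : (p : Fin (suc k) → Bool) → count p ≡ (if p zero then 1 else 0) ℕ.+ count (p ∘ suc)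
count-suc p with p zero
... | true  = cong suc (count-tail p)
... | false = count-tail p

count-mono : (p q : Fin k → Bool) → T ∘ p ⊆ T ∘ q → count p ℕ.≤ count q
count-mono {ℕ.zero} p q p⊆q = ℕ.z≤n
count-mono {suc k} p q p⊆q rewrite count-suc p | count-suc q
  with p zero | q zero | p⊆q {zero} | count-mono (p ∘ suc) (q ∘ suc) p⊆q
... | false | false | _    | ih = ih
... | false | true  | _    | ih = ℕₚ.m≤n⇒m≤1+n ih
... | true  | true  | _    | ih = ℕ.s≤s ih
... | true  | false | p⇒q₀ | _  = ⊥-elim (p⇒q₀ _)

count-< : (p q : Fin k → Bool) → T ∘ p ⊆ T ∘ q → ∀ w → T (q w) → ¬ T (p w) → count p ℕ.< count q
count-< p q p⊆q zero qw ¬pw rewrite count-suc p | count-suc q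
  with p zero | q zero | qw | ¬pw | count-mono (p ∘ suc) (q ∘ suc) p⊆q
... | false | true | _ | _ | tails = ℕ.s≤s tails
... | true  | _    | _ | ¬p₀ | _ = ⊥-elim (¬p₀ _)
count-< p q p⊆q (suc w) qw ¬pw rewrite count-suc p | count-suc q
  with p zero | q zero | p⊆q {zero} | count-< (p ∘ suc) (q ∘ suc) p⊆q w qw ¬pw
... | false | false | _    | ih = ih
... | false | true  | _    | ih = ℕₚ.m≤n⇒m≤1+n ih
... | true  | true  | _    | ih = ℕ.s≤s ih
... | true  | false | p⇒q₀ | _  = ⊥-elim (p⇒q₀ _)

count-cong : (p q : Fin k → Bool) → (∀ u → p u ≡ q u) → count p ≡ count q
count-cong p q p≗q = ℕₚ.≤-antisym (count-mono p q λ {u} → subst T (p≗q u))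
                                  (count-mono q p λ {u} → subst T (sym (p≗q u)))

count-none : (p : Fin k → Bool) → (∀ u → ¬ T (p u)) → count p ≡ 0
count-none p none = cong length (filter-none (T? ∘ p) (tabulate⁺ none))

count-≤1 : (p : Fin k → Bool) → (∀ u v → T (p u) → T (p v) → u ≡ v) → count p ℕ.≤ 1
count-≤1 {ℕ.zero} p unique = ℕ.z≤n
count-≤1 {suc k} p unique rewrite count-suc p with p zero | unique zero
... | true  | unique₀ = ℕ.s≤s (ℕₚ.≤-reflexive (count-none (p ∘ suc) λ u pu → 0≢1+n (unique₀ (suc u) _ pu)))
... | false | _       = count-≤1 (p ∘ suc) λ u v pu pv → suc-injective (unique (suc u) (suc v) pu pv)

count-insert : (p : Fin k → Bool) (w : Fin k) → ¬ T (p w) → count (λ u → ⌊ u ≟ w ⌋ ∨ p u) ≡ suc (count p)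
count-insert p zero ¬pw rewrite count-suc p | count-suc (λ u → ⌊ u ≟ zero ⌋ ∨ p u) with p zero | ¬pw
... | false | _   = refl
... | true  | ¬p₀ = ⊥-elim (¬p₀ _)
count-insert {suc k} p (suc w) ¬pw = begin
  count (λ u → ⌊ u ≟ suc w ⌋ ∨ p u)                    ≡⟨ count-suc (λ u → ⌊ u ≟ suc w ⌋ ∨ p u) ⟩
  head ℕ.+ count (λ u → ⌊ suc u ≟ suc w ⌋ ∨ p (suc u)) ≡⟨ cong (head ℕ.+_) (count-cong _ _ ⌊suc≟suc⌋∨) ⟩
  head ℕ.+ count (λ u → ⌊ u ≟ w ⌋ ∨ p (suc u))         ≡⟨ cong (head ℕ.+_) (count-insert (p ∘ suc) w ¬pw) ⟩
  head ℕ.+ suc (count (p ∘ suc))                       ≡⟨ ℕₚ.+-suc head _ ⟩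
  suc (head ℕ.+ count (p ∘ suc))                       ≡⟨ cong suc (count-suc p) ⟨
  suc (count p)                                        ∎
  where
  open ≡-Reasoning
  head : ℕ
  head = if p zero then 1 else 0
  -- ⌊_⌋ is isYes, which does not compute through the map′ in the suc/suc case of _≟_.
  ⌊suc≟suc⌋∨ : ∀ u → ⌊ suc u ≟ suc w ⌋ ∨ p (suc u) ≡ ⌊ u ≟ w ⌋ ∨ p (suc u)
  ⌊suc≟suc⌋∨ u = cong (_∨ p (suc u)) (⌊⌋-map′ (cong suc) suc-injective (u ≟ w))

rank : ∀ {n} (X : Subset n) {u} → u ∈ X → Fin ∣ X ∣
rank (inside  ∷ X) here        = zero
rank (inside  ∷ X) (there u∈X) = suc (rank X u∈X)
rank (outside ∷ X) (there u∈X) = rank X u∈X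

rank-injective : ∀ {n} (X : Subset n) {u v} (u∈X : u ∈ X) (v∈X : v ∈ X) → rank X u∈X ≡ rank X v∈X → u ≡ v
rank-injective (inside  ∷ X) here        here        _ = refl
rank-injective (inside  ∷ X) (there u∈X) (there v∈X) r = cong suc (rank-injective X u∈X v∈X (suc-injective r))
rank-injective (outside ∷ X) (there u∈X) (there v∈X) r = cong suc (rank-injective X u∈X v∈X r)

least : {P : Pred (Fin k) ℓ} → Decidable P → ∀ {v} → P v → ∃ λ u → P u × (∀ {w} → P w → u ≤ w)
least {suc k} P? {v} Pv with P? zero
... | yes P₀ = zero , P₀ , λ _ → ℕ.z≤n
least {suc k} P? {zero}  Pv | no ¬P₀ = contradiction Pv ¬P₀
least {suc k} {P = P} P? {suc v} Pv | no ¬P₀ with least (P? ∘ suc) Pv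
... | u , Pu , u≤ = suc u , Pu , below
  where
  below : ∀ {w} → P w → suc u ≤ w
  below {zero}  P₀ = contradiction P₀ ¬P₀
  below {suc w} Pw = ℕ.s≤s (u≤ Pw)

module _ (G : Graph) where

  ¬adj-self : ∀ v → ¬ T (adj G v v)
  ¬adj-self v = subst T (irrefl G v)

  adj-sym : ∀ {u v} → T (adj G u v) → T (adj G v u)
  adj-sym {u} {v} = subst T (Graph.sym G u v)

  closedNbhd⁺ : ∀ {v u} → u ≡ v ⊎ T (adj G v u) → T (inClosedNbhd G v u)
  closedNbhd⁺ {v} {u} = Equivalence.from (T-∨ {⌊ u ≟ v ⌋}) ∘ map₁ fromWitness

  closedNbhd⁻ : ∀ {v u} → T (inClosedNbhd G v u) → u ≡ v ⊎ T (adj G v u)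
  closedNbhd⁻ {v} {u} = map₁ toWitness ∘ Equivalence.to (T-∨ {⌊ u ≟ v ⌋})

  closedNbhd-∧⁻ : ∀ {v u} y → T (inClosedNbhd G v u ∧ y) → T (inClosedNbhd G v u) × T y
  closedNbhd-∧⁻ {v} {u} _ = Equivalence.to (T-∧ {inClosedNbhd G v u})

  count-closedNbhd : ∀ v → count (inClosedNbhd G v) ≡ suc (deg G v)
  count-closedNbhd v = count-insert (adj G v) v (¬adj-self v)

module ClusterColouring (G : Graph) (X : Subset (n G)) (isCluster : IsClusterAfterDeleting G X) where

  Vertex : Set
  Vertex = Fin (n G)

  part : Vertex → ℕ
  part = proj₁ isCluster

  closedNbhd⇒samePart : ∀ {v u} → v ∉ X → u ∉ X → T (inClosedNbhd G v u) → part u ≡ part v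
  closedNbhd⇒samePart {v} {u} v∉X u∉X vu with closedNbhd⁻ G vu
  ... | inj₁ refl = refl
  ... | inj₂ adj-vu = sym (proj₁ (proj₂ isCluster v u v∉X u∉X v≢u) (Equivalence.to T-≡ adj-vu))
    where
    v≢u : v ≢ u
    v≢u refl = ¬adj-self G v adj-vu

  samePart⇒closedNbhd : ∀ {v u} → v ∉ X → u ∉ X → part u ≡ part v → T (inClosedNbhd G v u)
  samePart⇒closedNbhd {v} {u} v∉X u∉X same = closedNbhd⁺ G (case u ≟ v of λ where
    (yes u≡v) → inj₁ u≡v
    (no u≢v)  → inj₂ (Equivalence.from T-≡ (proj₂ (proj₂ isCluster v u v∉X u∉X (u≢v ∘ sym)) (sym same))))

  Detached : Pred Vertex _
  Detached u = u ∉ X × (∀ x → x ∈ X → ¬ T (adj G u x))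

  detached? : Decidable Detached
  detached? u = ¬? (u ∈? X) ×-dec all? (λ x → x ∈? X →-dec ¬? (T? (adj G u x)))

  Representative : Pred Vertex _
  Representative r = Detached r × (∀ w → Detached w → part w ≡ part r → r ≤ w)

  representative? : Decidable Representative
  representative? r = detached? r ×-dec all? (λ w → detached? w →-dec (part w ℕ.≟ part r →-dec r ≤? w))

  representative-unique : ∀ {r s} → Representative r → Representative s → part r ≡ part s → r ≡ s
  representative-unique {r} {s} (dr , r≤) (ds , s≤) same = ≤-antisym (r≤ s ds (sym same)) (s≤ r dr same)

  representative-exists : ∀ {v} → Detached v → ∃ λ r → Representative r × part r ≡ part v
  representative-exists {v} dv with least (λ u → detached? u ×-dec part u ℕ.≟ part v) (dv , refl)
  ... | r , (dr , same) , r≤ = r , (dr , λ w dw w~r → r≤ (dw , trans w~r same)) , same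

  representative-closedNbhd⇒∉X : ∀ {v r} → Representative r → T (inClosedNbhd G v r) → v ∉ X
  representative-closedNbhd⇒∉X ((r∉X , r≁X) , _) vr v∈X with closedNbhd⁻ G vr
  ... | inj₁ refl   = r∉X v∈X
  ... | inj₂ adj-vr = r≁X _ v∈X (adj-sym G adj-vr)

  representative-closedNbhd⇒samePart : ∀ {v r} → Representative r → T (inClosedNbhd G v r) → part r ≡ part v
  representative-closedNbhd⇒samePart rep vr =
    closedNbhd⇒samePart (representative-closedNbhd⇒∉X rep vr) (proj₁ (proj₁ rep)) vr

  colour : Vertex → Fin (suc (suc ∣ X ∣))
  colour u with u ∈? X | representative? u
  ... | yes u∈X | _     = suc (inject₁ (rank X u∈X))
  ... | no _    | yes _ = suc (fromℕ ∣ X ∣)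
  ... | no _    | no _  = zero

  colour-suc⁻ : ∀ {u i} → colour u ≡ suc i →
                (∃ λ (u∈X : u ∈ X) → inject₁ (rank X u∈X) ≡ i) ⊎ (Representative u × fromℕ ∣ X ∣ ≡ i)
  colour-suc⁻ {u} eq with u ∈? X | representative? u
  colour-suc⁻ refl | yes u∈X | _     = inj₁ (u∈X , refl)
  colour-suc⁻ refl | no _    | yes r = inj₂ (r , refl)

  colour-nonzero : ∀ {u} → u ∈ X ⊎ Representative u → ¬ T (isZero (colour u))
  colour-nonzero {u} u∈X⊎r with u ∈? X | representative? u
  ... | yes _ | _     = id
  ... | no _  | yes _ = id
  colour-nonzero (inj₁ u∈X) | no u∉X | no _  = contradiction u∈X u∉X
  colour-nonzero (inj₂ r)   | no _   | no ¬r = contradiction r ¬r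

  colourClass-unique : ∀ {v x y i} → T (inClosedNbhd G v x) → T (inClosedNbhd G v y) →
                       colour x ≡ suc i → colour y ≡ suc i → x ≡ y
  colourClass-unique {v} {x} {y} vx vy cx cy with colour-suc⁻ {x} cx | colour-suc⁻ {y} cy
  ... | inj₁ (x∈X , rx) | inj₁ (y∈X , ry) = rank-injective X x∈X y∈X (inject₁-injective (trans rx (sym ry)))
  ... | inj₁ (_ , rx)   | inj₂ (_ , ry)   = contradiction (trans ry (sym rx)) fromℕ≢inject₁
  ... | inj₂ (_ , rx)   | inj₁ (_ , ry)   = contradiction (trans rx (sym ry)) fromℕ≢inject₁
  ... | inj₂ (rep-x , _) | inj₂ (rep-y , _) = representative-unique rep-x rep-y
    (trans (representative-closedNbhd⇒samePart rep-x vx) (sym (representative-closedNbhd⇒samePart rep-y vy)))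

  nonzero-in-closedNbhd : ∀ v → ∃ λ w → T (inClosedNbhd G v w) × ¬ T (isZero (colour w))
  nonzero-in-closedNbhd v with v ∈? X
  ... | yes v∈X = v , closedNbhd⁺ G (inj₁ refl) , colour-nonzero (inj₁ v∈X)
  ... | no v∉X with any? (λ x → x ∈? X ×-dec T? (adj G v x))
  ...   | yes (x , x∈X , vx) = x , closedNbhd⁺ G (inj₂ vx) , colour-nonzero (inj₁ x∈X)
  ...   | no v≁X with representative-exists (v∉X , λ x x∈X vx → v≁X (x , x∈X , vx))
  ...     | r , rep , same = r , samePart⇒closedNbhd v∉X (proj₁ (proj₁ rep)) same , colour-nonzero (inj₂ rep)

  colourClass-≤1 : ∀ v i → count (λ u → inClosedNbhd G v u ∧ ⌊ colour u ≟ suc i ⌋) ℕ.≤ 1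
  colourClass-≤1 v i = count-≤1 _ λ x y x∈ y∈ →
    let (vx , cx) = closedNbhd-∧⁻ G _ x∈ ; (vy , cy) = closedNbhd-∧⁻ G _ y∈
    in colourClass-unique vx vy (toWitness cx) (toWitness cy)

  zeros-<-closedNbhd : ∀ v → count (λ u → inClosedNbhd G v u ∧ isZero (colour u)) ℕ.< count (inClosedNbhd G v)
  zeros-<-closedNbhd v with nonzero-in-closedNbhd v
  ... | w , vw , nz = count-< _ _ (proj₁ ∘ closedNbhd-∧⁻ G _) w vw (nz ∘ proj₂ ∘ closedNbhd-∧⁻ G _)

  isColouring : IsSubsetSquareColouring G (suc ∣ X ∣) colour
  isColouring = record
    { cond-i  = colourClass-≤1
    ; cond-ii = λ v → ℕ.s≤s⁻¹ (ℕₚ.<-≤-trans (zeros-<-closedNbhd v) (ℕₚ.≤-reflexive (count-closedNbhd G v)))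
    }

lemma13 : (G : Graph) (X : Subset (n G)) → IsClusterAfterDeleting G X → χssc≤ G (suc ∣ X ∣)
lemma13 G X isCluster = suc ∣ X ∣ , ℕ.s≤s ℕ.z≤n , ℕₚ.≤-refl , colour , isColouring
  where open ClusterColouring G X isCluster
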